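{- If $G$ is a $k$-regular simple graph with $k\le 8$, then its $2$-Laplacian $L^{(2)}_G$ is positive semi-definite.
   Context: For a simple graph $G$ with adjacency matrix $A_G$ and degree matrix $D_G$ (diagonal matrix of vertex degrees), let $A'=\frac{1}{12}\left(16A_G-A_G^2+D_G\right)$ and let $D'$ be the diagonal matrix whose $(i,i)$ entry is the sum of the entries of the $i$th row of $A'$. The $2$-Laplacian of $G$ is $L^{(2)}_G=D'-A'$.
   Formalization: Positive semi-definiteness of $L^{(2)}_G$ is tested only on vectors with rational entries rather than real ones. -}

module Defs where

open import Data.Bool using (Bool; true; false; if_then_else_)
open import Data.Nat using (ℕ; zero; suc)
open import Data.Fin using (Fin; zero; suc)
import Data.Fin as Fin
open import Data.Integer using (+_)
open import Data.Rational using (ℚ; 0ℚ; 1ℚ; _+_; _*_; _-_; _/_; _≤_)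
open import Relation.Nullary using (does)
open import Relation.Binary.PropositionalEquality using (_≡_)

Σ : (n : ℕ) → (Fin n → ℚ) → ℚ
Σ zero    f = 0ℚ
Σ (suc n) f = f zero + Σ n (λ i → f (suc i))

Matrix : ℕ → Set
Matrix n = Fin n → Fin n → ℚ

record SimpleGraph (n : ℕ) : Set where
  field
    adj    : Fin n → Fin n → Bool
    sym    : ∀ i j → adj i j ≡ adj j i
    irrefl : ∀ i → adj i i ≡ false
open SimpleGraph public

degree : ∀ {n} → SimpleGraph n → Fin n → ℕ
degree {n} G i = count n (λ j → adj G i j)
  where
  count : (m : ℕ) → (Fin m → Bool) → ℕ
  count zero    b = 0
  count (suc m) b = (if b zero then 1 else 0) Data.Nat.+ count m (λ j → b (suc j))

IsRegular : ∀ {n} → SimpleGraph n → ℕ → Set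
IsRegular {n} G k = ∀ (i : Fin n) → degree G i ≡ k

adjMatrix : ∀ {n} → SimpleGraph n → Matrix n
adjMatrix G i j = if adj G i j then 1ℚ else 0ℚ

degMatrix : ∀ {n} → SimpleGraph n → Matrix n
degMatrix G i j = if does (i Fin.≟ j) then (+ degree G i) / 1 else 0ℚ

matMul : ∀ {n} → Matrix n → Matrix n → Matrix n
matMul {n} M N i j = Σ n (λ l → M i l * N l j)

A′ : ∀ {n} → SimpleGraph n → Matrix n
A′ G i j =
  (+ 1 / 12) * (((+ 16 / 1) * adjMatrix G i j - matMul (adjMatrix G) (adjMatrix G) i j)
                 + degMatrix G i j)

D′ : ∀ {n} → SimpleGraph n → Matrix n
D′ {n} G i j = if does (i Fin.≟ j) then Σ n (λ l → A′ G i l) else 0ℚ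

twoLaplacian : ∀ {n} → SimpleGraph n → Matrix n
twoLaplacian G i j = D′ G i j - A′ G i j

quadForm : ∀ {n} → Matrix n → (Fin n → ℚ) → ℚ
quadForm {n} M x = Σ n (λ i → Σ n (λ j → x i * M i j * x j))

PosSemidef : ∀ {n} → Matrix n → Set
PosSemidef {n} M = ∀ (x : Fin n → ℚ) → 0ℚ ≤ quadForm M x

{-# OPTIONS --safe #-}
-- For a k-regular graph the rows of A' all sum to (17k - k²)/12, so D' is scalar and
-- 12 L⁽²⁾ = (16k - k²) I - 16 A + A² = L² + 2 (8 - k) L, where L = kI - A is the ordinary
-- Laplacian. Hence 12 xᵀL⁽²⁾x = |(kI - A) x|² + 2 (8 - k) xᵀLx, and xᵀLx = ½ Σᵢⱼ aᵢⱼ (xᵢ - xⱼ)²,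
-- so both terms are nonnegative once k ≤ 8.
module Submission where

open import Data.Bool using (Bool; true; false; if_then_else_)
open import Data.Fin as Fin using (Fin; zero; suc)
import Data.Integer as ℤ
import Data.Integer.Properties as ℤ
open import Data.Nat as ℕ using (ℕ; _≤_)
import Data.Nat.Properties as ℕ
open import Data.Nat.Coprimality using (1-coprimeTo) renaming (sym to coprime-sym)
open import Data.Rational using (ℚ; 0ℚ; 1ℚ; _+_; _*_; _-_; -_; _/_; nonNegative; nonPositive)
  renaming (_≤_ to _≤ℚ_)
open import Data.Rational.Properties
open import Data.Rational.Solver using (module +-*-Solver)
open import Data.Sum using (inj₁; inj₂)
open import Function using (_∘_)
open import Relation.Nullary using (does)
open import Relation.Binary.PropositionalEquality
open import Defs hiding (sym)

open +-*-Solver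
open ≡-Reasoning

fromℕ : ℕ → ℚ
fromℕ m = ℤ.+ m / 1

fromℕ-homo-+ : ∀ m n → fromℕ (m ℕ.+ n) ≡ fromℕ m + fromℕ n
fromℕ-homo-+ m n = sym (begin
  fromℕ m + fromℕ n
    ≡⟨ cong₂ _+_ (normalize-coprime (coprime-sym (1-coprimeTo m)))
                 (normalize-coprime (coprime-sym (1-coprimeTo n))) ⟩
  (ℤ.+ m ℤ.* ℤ.+ 1 ℤ.+ ℤ.+ n ℤ.* ℤ.+ 1) / 1
    ≡⟨ cong₂ (λ a b → (a ℤ.+ b) / 1) (ℤ.*-identityʳ (ℤ.+ m)) (ℤ.*-identityʳ (ℤ.+ n)) ⟩
  fromℕ (m ℕ.+ n) ∎)

fromℕ-nonNeg : ∀ m → 0ℚ ≤ℚ fromℕ m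
fromℕ-nonNeg m = nonNegative⁻¹ (fromℕ m) {{normalize-nonNeg m 1}}

fromℕ-difference-nonNeg : ∀ {m n} → m ≤ n → 0ℚ ≤ℚ fromℕ n - fromℕ m
fromℕ-difference-nonNeg {m} {n} m≤n = subst (0ℚ ≤ℚ_) fromℕ-∸ (fromℕ-nonNeg (n ℕ.∸ m))
  where
  fromℕ-∸ : fromℕ (n ℕ.∸ m) ≡ fromℕ n - fromℕ m
  fromℕ-∸ = begin
    fromℕ (n ℕ.∸ m)                          ≡⟨ solve 2 (λ a d → d := (a :+ d) :- a) refl (fromℕ m) _ ⟩
    (fromℕ m + fromℕ (n ℕ.∸ m)) - fromℕ m    ≡⟨ cong (_- fromℕ m) (fromℕ-homo-+ m (n ℕ.∸ m)) ⟨
    fromℕ (m ℕ.+ (n ℕ.∸ m)) - fromℕ m        ≡⟨ cong (λ a → fromℕ a - fromℕ m) (ℕ.m+[n∸m]≡n m≤n) ⟩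
    fromℕ n - fromℕ m                        ∎

*-nonNeg : ∀ {p q} → 0ℚ ≤ℚ p → 0ℚ ≤ℚ q → 0ℚ ≤ℚ p * q
*-nonNeg {p} {q} 0≤p 0≤q =
  nonNegative⁻¹ (p * q) {{nonNeg*nonNeg⇒nonNeg p {{nonNegative 0≤p}} q {{nonNegative 0≤q}}}}

square-nonNeg : ∀ p → 0ℚ ≤ℚ p * p
square-nonNeg p with ≤-total 0ℚ p
... | inj₁ 0≤p = *-nonNeg 0≤p 0≤p
... | inj₂ p≤0 = subst (_≤ℚ p * p) (*-zeroˡ p) (*-monoʳ-≤-nonPos p {{nonPositive p≤0}} p≤0)

Σ-cong : ∀ n {f g : Fin n → ℚ} → (∀ i → f i ≡ g i) → Σ n f ≡ Σ n g
Σ-cong ℕ.zero    f≗g = refl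
Σ-cong (ℕ.suc n) f≗g = cong₂ _+_ (f≗g zero) (Σ-cong n (f≗g ∘ suc))

Σ-zero : ∀ n → Σ n (λ _ → 0ℚ) ≡ 0ℚ
Σ-zero ℕ.zero    = refl
Σ-zero (ℕ.suc n) = trans (+-identityˡ _) (Σ-zero n)

Σ-distrib-+ : ∀ n (f g : Fin n → ℚ) → Σ n (λ i → f i + g i) ≡ Σ n f + Σ n g
Σ-distrib-+ ℕ.zero    f g = refl
Σ-distrib-+ (ℕ.suc n) f g = begin
  (f zero + g zero) + Σ n (λ i → f (suc i) + g (suc i))
    ≡⟨ cong ((f zero + g zero) +_) (Σ-distrib-+ n (f ∘ suc) (g ∘ suc)) ⟩
  (f zero + g zero) + (Σ n (f ∘ suc) + Σ n (g ∘ suc))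
    ≡⟨ solve 4 (λ a b c d → (a :+ b) :+ (c :+ d) := (a :+ c) :+ (b :+ d)) refl
         (f zero) (g zero) (Σ n (f ∘ suc)) (Σ n (g ∘ suc)) ⟩
  (f zero + Σ n (f ∘ suc)) + (g zero + Σ n (g ∘ suc)) ∎

Σ-neg : ∀ n (f : Fin n → ℚ) → Σ n (λ i → - f i) ≡ - Σ n f
Σ-neg ℕ.zero    f = refl
Σ-neg (ℕ.suc n) f = trans (cong (- f zero +_) (Σ-neg n (f ∘ suc))) (sym (neg-distrib-+ (f zero) _))

Σ-distrib-- : ∀ n (f g : Fin n → ℚ) → Σ n (λ i → f i - g i) ≡ Σ n f - Σ n g
Σ-distrib-- n f g = trans (Σ-distrib-+ n f (λ i → - g i)) (cong (Σ n f +_) (Σ-neg n g))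

*-distribˡ-Σ : ∀ n c (f : Fin n → ℚ) → c * Σ n f ≡ Σ n (λ i → c * f i)
*-distribˡ-Σ ℕ.zero    c f = *-zeroʳ c
*-distribˡ-Σ (ℕ.suc n) c f =
  trans (*-distribˡ-+ c (f zero) _) (cong (c * f zero +_) (*-distribˡ-Σ n c (f ∘ suc)))

*-distribʳ-Σ : ∀ n c (f : Fin n → ℚ) → Σ n f * c ≡ Σ n (λ i → f i * c)
*-distribʳ-Σ n c f = trans (*-comm _ c) (trans (*-distribˡ-Σ n c f) (Σ-cong n (λ i → *-comm c (f i))))

Σ-comm : ∀ m n (f : Fin m → Fin n → ℚ) → Σ m (λ i → Σ n (f i)) ≡ Σ n (λ j → Σ m (λ i → f i j))
Σ-comm ℕ.zero    n f = sym (Σ-zero n)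
Σ-comm (ℕ.suc m) n f = trans (cong (Σ n (f zero) +_) (Σ-comm m n (f ∘ suc)))
                             (sym (Σ-distrib-+ n (f zero) _))

Σ-δ : ∀ n (i : Fin n) (f : Fin n → ℚ) → Σ n (λ j → if does (i Fin.≟ j) then f j else 0ℚ) ≡ f i
Σ-δ (ℕ.suc n) zero    f = trans (cong (f zero +_) (Σ-zero n)) (+-identityʳ _)
Σ-δ (ℕ.suc n) (suc i) f = trans (+-identityˡ _) (Σ-δ n i (f ∘ suc))

Σ-nonNeg : ∀ n (f : Fin n → ℚ) → (∀ i → 0ℚ ≤ℚ f i) → 0ℚ ≤ℚ Σ n f
Σ-nonNeg ℕ.zero    f 0≤f = ≤-refl
Σ-nonNeg (ℕ.suc n) f 0≤f = +-mono-≤ (0≤f zero) (Σ-nonNeg n (f ∘ suc) (0≤f ∘ suc))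

module _ {n : ℕ} where

  quadForm-cong : {M N : Matrix n} → (∀ i j → M i j ≡ N i j) → ∀ x → quadForm M x ≡ quadForm N x
  quadForm-cong M≗N x = Σ-cong n (λ i → Σ-cong n (λ j → cong (λ m → x i * m * x j) (M≗N i j)))

  quadForm-+ : ∀ (M N : Matrix n) x →
               quadForm (λ i j → M i j + N i j) x ≡ quadForm M x + quadForm N x
  quadForm-+ M N x =
    trans (Σ-cong n (λ i → trans (Σ-cong n (λ j → distrib i j)) (Σ-distrib-+ n _ _))) (Σ-distrib-+ n _ _)
    where
    distrib : ∀ i j → x i * (M i j + N i j) * x j ≡ x i * M i j * x j + x i * N i j * x j
    distrib i j = solve 4 (λ a m m′ b → a :* (m :+ m′) :* b := a :* m :* b :+ a :* m′ :* b) refl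
                    (x i) (M i j) (N i j) (x j)

  quadForm-*ˡ : ∀ c (M : Matrix n) x → quadForm (λ i j → c * M i j) x ≡ c * quadForm M x
  quadForm-*ˡ c M x = sym (trans (*-distribˡ-Σ n c _) (Σ-cong n (λ i →
    trans (*-distribˡ-Σ n c _) (Σ-cong n (λ j →
      solve 4 (λ c a m b → c :* (a :* m :* b) := a :* (c :* m) :* b) refl c (x i) (M i j) (x j))))))

  quadForm-neg : ∀ (M : Matrix n) x → quadForm (λ i j → - M i j) x ≡ - quadForm M x
  quadForm-neg M x =
    trans (Σ-cong n (λ i → trans (Σ-cong n (λ j → neg-inside i j)) (Σ-neg n _))) (Σ-neg n _)
    where
    neg-inside : ∀ i j → x i * - M i j * x j ≡ - (x i * M i j * x j)
    neg-inside i j = solve 3 (λ a m b → a :* (:- m) :* b := :- (a :* m :* b)) refl (x i) (M i j) (x j)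

  quadForm-- : ∀ (M N : Matrix n) x →
               quadForm (λ i j → M i j - N i j) x ≡ quadForm M x - quadForm N x
  quadForm-- M N x = trans (quadForm-+ M (λ i j → - N i j) x) (cong (quadForm M x +_) (quadForm-neg N x))

  quadForm-diagonal : ∀ (d : Fin n → ℚ) x →
    quadForm (λ i j → if does (i Fin.≟ j) then d i else 0ℚ) x ≡ Σ n (λ i → d i * (x i * x i))
  quadForm-diagonal d x = Σ-cong n (λ i → begin
    Σ n (λ j → x i * (if does (i Fin.≟ j) then d i else 0ℚ) * x j)
      ≡⟨ Σ-cong n (λ j → pull-in (does (i Fin.≟ j)) (x i) (d i) (x j)) ⟩
    Σ n (λ j → if does (i Fin.≟ j) then x i * d i * x j else 0ℚ)
      ≡⟨ Σ-δ n i (λ j → x i * d i * x j) ⟩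
    x i * d i * x i
      ≡⟨ solve 2 (λ a e → a :* e :* a := e :* (a :* a)) refl (x i) (d i) ⟩
    d i * (x i * x i) ∎)
    where
    pull-in : ∀ b p q r → p * (if b then q else 0ℚ) * r ≡ (if b then p * q * r else 0ℚ)
    pull-in true  p q r = refl
    pull-in false p q r = trans (cong (_* r) (*-zeroʳ p)) (*-zeroˡ r)

  matVec : Matrix n → (Fin n → ℚ) → Fin n → ℚ
  matVec M x i = Σ n (λ j → M i j * x j)

  quadForm-scalar : ∀ c x → quadForm (λ i j → if does (i Fin.≟ j) then c else 0ℚ) x ≡ c * Σ n (λ i → x i * x i)
  quadForm-scalar c x = trans (quadForm-diagonal (λ _ → c) x) (sym (*-distribˡ-Σ n c _))

  quadForm-matVec : ∀ (M : Matrix n) x → quadForm M x ≡ Σ n (λ i → x i * matVec M x i)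
  quadForm-matVec M x = Σ-cong n (λ i → trans (Σ-cong n (λ j → *-assoc (x i) (M i j) (x j)))
                                            (sym (*-distribˡ-Σ n (x i) _)))

  quadForm-matMul-sym : ∀ (M : Matrix n) → (∀ i j → M i j ≡ M j i) → ∀ x →
    quadForm (matMul M M) x ≡ Σ n (λ l → matVec M x l * matVec M x l)
  quadForm-matMul-sym M M-sym x = begin
    Σ n (λ i → Σ n (λ j → x i * Σ n (λ l → M i l * M l j) * x j))
      ≡⟨ Σ-cong n (λ i → Σ-cong n (λ j → expand i j)) ⟩
    Σ n (λ i → Σ n (λ j → Σ n (λ l → (M l i * x i) * (M l j * x j))))
      ≡⟨ Σ-cong n (λ i → Σ-comm n n _) ⟩
    Σ n (λ i → Σ n (λ l → Σ n (λ j → (M l i * x i) * (M l j * x j))))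
      ≡⟨ Σ-comm n n _ ⟩
    Σ n (λ l → Σ n (λ i → Σ n (λ j → (M l i * x i) * (M l j * x j))))
      ≡⟨ Σ-cong n (λ l → Σ-cong n (λ i → *-distribˡ-Σ n (M l i * x i) _)) ⟨
    Σ n (λ l → Σ n (λ i → (M l i * x i) * matVec M x l))
      ≡⟨ Σ-cong n (λ l → *-distribʳ-Σ n (matVec M x l) _) ⟨
    Σ n (λ l → matVec M x l * matVec M x l) ∎
    where
    expand : ∀ i j → x i * Σ n (λ l → M i l * M l j) * x j
                   ≡ Σ n (λ l → (M l i * x i) * (M l j * x j))
    expand i j = begin
      x i * Σ n (λ l → M i l * M l j) * x j
        ≡⟨ cong (_* x j) (*-distribˡ-Σ n (x i) _) ⟩
      Σ n (λ l → x i * (M i l * M l j)) * x j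
        ≡⟨ *-distribʳ-Σ n (x j) _ ⟩
      Σ n (λ l → x i * (M i l * M l j) * x j)
        ≡⟨ Σ-cong n (λ l → cong (λ m → x i * (m * M l j) * x j) (M-sym i l)) ⟩
      Σ n (λ l → x i * (M l i * M l j) * x j)
        ≡⟨ Σ-cong n (λ l → solve 4 (λ a p q b → a :* (p :* q) :* b := (p :* a) :* (q :* b)) refl
                           (x i) (M l i) (M l j) (x j)) ⟩
      Σ n (λ l → (M l i * x i) * (M l j * x j)) ∎

star : (m : ℕ) → (Fin m → Bool) → Fin (ℕ.suc m) → Fin (ℕ.suc m) → Bool
star m b zero    (suc j) = b j
star m b (suc i) zero    = b i
star m b _       _       = false

starGraph : (m : ℕ) → (Fin m → Bool) → SimpleGraph (ℕ.suc m)
starGraph m b = record { adj = star m b ; sym = star-sym ; irrefl = star-irrefl }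
  where
  star-sym : ∀ i j → star m b i j ≡ star m b j i
  star-sym zero    zero    = refl
  star-sym zero    (suc j) = refl
  star-sym (suc i) zero    = refl
  star-sym (suc i) (suc j) = refl

  star-irrefl : ∀ i → star m b i i ≡ false
  star-irrefl zero    = refl
  star-irrefl (suc i) = refl

-- `degree` counts neighbours with a function local to its `where` block, which has no name
-- outside Defs. At the centre of a star graph, after abstracting the graph, that function is
-- applied to variables only, so unification with `neighbourCount` names it.
mutual
  neighbourCount : ∀ {n} → SimpleGraph n → Fin n → (m : ℕ) → (Fin m → Bool) → ℕ
  neighbourCount = _

  private
    degree-starGraph : ∀ m b → degree (starGraph m b) zero ≡ neighbourCount (starGraph m b) zero m b
    degree-starGraph m b with ℕ.suc m | starGraph m b | Fin.zero {m}
    ... | _ | G | centre = refl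

neighbourCount-Σ : ∀ {n} (G : SimpleGraph n) v m (b : Fin m → Bool) →
                   fromℕ (neighbourCount G v m b) ≡ Σ m (λ j → if b j then 1ℚ else 0ℚ)
neighbourCount-Σ G v ℕ.zero    b = refl
neighbourCount-Σ G v (ℕ.suc m) b with b zero
... | true  = trans (fromℕ-homo-+ 1 (neighbourCount G v m (b ∘ suc)))
                    (cong (1ℚ +_) (neighbourCount-Σ G v m (b ∘ suc)))
... | false = trans (neighbourCount-Σ G v m (b ∘ suc)) (sym (+-identityˡ _))

degree-Σ-adjMatrix : ∀ {n} (G : SimpleGraph n) i → fromℕ (degree G i) ≡ Σ n (adjMatrix G i)
degree-Σ-adjMatrix {n} G i = neighbourCount-Σ G i n (adj G i)

module _ {n : ℕ} (G : SimpleGraph n) where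

  laplacian : Matrix n
  laplacian i j = degMatrix G i j - adjMatrix G i j

  adjMatrix-sym : ∀ i j → adjMatrix G i j ≡ adjMatrix G j i
  adjMatrix-sym i j = cong (λ b → if b then 1ℚ else 0ℚ) (SimpleGraph.sym G i j)

  adjMatrix-nonNeg : ∀ i j → 0ℚ ≤ℚ adjMatrix G i j
  adjMatrix-nonNeg i j with adj G i j
  ... | true  = nonNegative⁻¹ 1ℚ
  ... | false = ≤-refl

  quadForm-laplacian-edges : ∀ x → quadForm laplacian x
    ≡ Σ n (λ i → Σ n (λ j → adjMatrix G i j * x i * (x i - x j)))
  quadForm-laplacian-edges x = begin
    quadForm laplacian x
      ≡⟨ quadForm-- (degMatrix G) (adjMatrix G) x ⟩
    quadForm (degMatrix G) x - quadForm (adjMatrix G) x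
      ≡⟨ cong (_- quadForm (adjMatrix G) x) (quadForm-diagonal (fromℕ ∘ degree G) x) ⟩
    Σ n (λ i → fromℕ (degree G i) * (x i * x i)) - quadForm (adjMatrix G) x
      ≡⟨ cong (_- quadForm (adjMatrix G) x) (Σ-cong n (λ i →
           trans (cong (_* (x i * x i)) (degree-Σ-adjMatrix G i)) (*-distribʳ-Σ n (x i * x i) _))) ⟩
    Σ n (λ i → Σ n (λ j → adjMatrix G i j * (x i * x i))) - quadForm (adjMatrix G) x
      ≡⟨ Σ-distrib-- n _ _ ⟨
    Σ n (λ i → Σ n (λ j → adjMatrix G i j * (x i * x i)) - Σ n (λ j → x i * adjMatrix G i j * x j))
      ≡⟨ Σ-cong n (λ i → Σ-distrib-- n _ _) ⟨
    Σ n (λ i → Σ n (λ j → adjMatrix G i j * (x i * x i) - x i * adjMatrix G i j * x j))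
      ≡⟨ Σ-cong n (λ i → Σ-cong n (λ j →
           solve 3 (λ a u v → a :* (u :* u) :- u :* a :* v := a :* u :* (u :- v)) refl
             (adjMatrix G i j) (x i) (x j))) ⟩
    Σ n (λ i → Σ n (λ j → adjMatrix G i j * x i * (x i - x j))) ∎

  -- Each edge is counted from both ends.
  quadForm-laplacian : ∀ x → quadForm laplacian x
    ≡ (ℤ.+ 1 / 2) * Σ n (λ i → Σ n (λ j → adjMatrix G i j * ((x i - x j) * (x i - x j))))
  quadForm-laplacian x = begin
    quadForm laplacian x
      ≡⟨ quadForm-laplacian-edges x ⟩
    Σ n (λ i → Σ n (g i))
      ≡⟨ solve 1 (λ s → s := con (ℤ.+ 1 / 2) :* (s :+ s)) refl _ ⟩
    (ℤ.+ 1 / 2) * (Σ n (λ i → Σ n (g i)) + Σ n (λ i → Σ n (g i)))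
      ≡⟨ cong (λ s → (ℤ.+ 1 / 2) * (Σ n (λ i → Σ n (g i)) + s)) (Σ-comm n n g) ⟩
    (ℤ.+ 1 / 2) * (Σ n (λ i → Σ n (g i)) + Σ n (λ i → Σ n (λ j → g j i)))
      ≡⟨ cong ((ℤ.+ 1 / 2) *_) (trans (sym (Σ-distrib-+ n _ _)) (Σ-cong n (λ i → sym (Σ-distrib-+ n _ _)))) ⟩
    (ℤ.+ 1 / 2) * Σ n (λ i → Σ n (λ j → g i j + g j i))
      ≡⟨ cong ((ℤ.+ 1 / 2) *_) (Σ-cong n (λ i → Σ-cong n (λ j → both-ends i j))) ⟩
    (ℤ.+ 1 / 2) * Σ n (λ i → Σ n (λ j → adjMatrix G i j * ((x i - x j) * (x i - x j)))) ∎
    where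
    g : Fin n → Fin n → ℚ
    g i j = adjMatrix G i j * x i * (x i - x j)

    both-ends : ∀ i j → g i j + g j i ≡ adjMatrix G i j * ((x i - x j) * (x i - x j))
    both-ends i j = begin
      g i j + adjMatrix G j i * x j * (x j - x i)
        ≡⟨ cong (λ a → g i j + a * x j * (x j - x i)) (adjMatrix-sym j i) ⟩
      g i j + adjMatrix G i j * x j * (x j - x i)
        ≡⟨ solve 3 (λ a u v → a :* u :* (u :- v) :+ a :* v :* (v :- u) := a :* ((u :- v) :* (u :- v)))
             refl (adjMatrix G i j) (x i) (x j) ⟩
      adjMatrix G i j * ((x i - x j) * (x i - x j)) ∎

  laplacian-posSemidef : PosSemidef laplacian
  laplacian-posSemidef x = subst (0ℚ ≤ℚ_) (sym (quadForm-laplacian x))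
    (*-nonNeg (nonNegative⁻¹ (ℤ.+ 1 / 2)) (Σ-nonNeg n _ (λ i → Σ-nonNeg n _ (λ j →
      *-nonNeg (adjMatrix-nonNeg i j) (square-nonNeg (x i - x j))))))

module Regular {n k : ℕ} (G : SimpleGraph n) (regular : IsRegular G k) where

  K : ℚ
  K = fromℕ k

  R : ℚ
  R = (ℤ.+ 1 / 12) * ((ℤ.+ 16 / 1 * K - K * K) + K)

  Σ-adjMatrix-row : ∀ i → Σ n (adjMatrix G i) ≡ K
  Σ-adjMatrix-row i = trans (sym (degree-Σ-adjMatrix G i)) (cong fromℕ (regular i))

  degMatrix-regular : ∀ i j → degMatrix G i j ≡ (if does (i Fin.≟ j) then K else 0ℚ)
  degMatrix-regular i j = cong (λ d → if does (i Fin.≟ j) then fromℕ d else 0ℚ) (regular i)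

  Σ-adjMatrix²-row : ∀ i → Σ n (matMul (adjMatrix G) (adjMatrix G) i) ≡ K * K
  Σ-adjMatrix²-row i = begin
    Σ n (λ j → Σ n (λ l → adjMatrix G i l * adjMatrix G l j))
      ≡⟨ Σ-comm n n _ ⟩
    Σ n (λ l → Σ n (λ j → adjMatrix G i l * adjMatrix G l j))
      ≡⟨ Σ-cong n (λ l → sym (*-distribˡ-Σ n (adjMatrix G i l) (adjMatrix G l))) ⟩
    Σ n (λ l → adjMatrix G i l * Σ n (adjMatrix G l))
      ≡⟨ Σ-cong n (λ l → cong (adjMatrix G i l *_) (Σ-adjMatrix-row l)) ⟩
    Σ n (λ l → adjMatrix G i l * K)
      ≡⟨ *-distribʳ-Σ n K (adjMatrix G i) ⟨
    Σ n (adjMatrix G i) * K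
      ≡⟨ cong (_* K) (Σ-adjMatrix-row i) ⟩
    K * K ∎

  Σ-A′-row : ∀ i → Σ n (A′ G i) ≡ R
  Σ-A′-row i = begin
    Σ n (λ l → (ℤ.+ 1 / 12) * ((ℤ.+ 16 / 1 * adjMatrix G i l - matMul (adjMatrix G) (adjMatrix G) i l)
                               + degMatrix G i l))
      ≡⟨ *-distribˡ-Σ n (ℤ.+ 1 / 12) _ ⟨
    (ℤ.+ 1 / 12) * Σ n (λ l → (ℤ.+ 16 / 1 * adjMatrix G i l - matMul (adjMatrix G) (adjMatrix G) i l)
                              + degMatrix G i l)
      ≡⟨ cong ((ℤ.+ 1 / 12) *_) (trans (Σ-distrib-+ n _ _) (cong₂ _+_
           (trans (Σ-distrib-- n _ _) (cong₂ _-_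
             (trans (sym (*-distribˡ-Σ n (ℤ.+ 16 / 1) (adjMatrix G i))) (cong (ℤ.+ 16 / 1 *_) (Σ-adjMatrix-row i)))
             (Σ-adjMatrix²-row i)))
           (trans (Σ-cong n (degMatrix-regular i)) (Σ-δ n i (λ _ → K))))) ⟩
    R ∎

  D′-regular : ∀ i j → D′ G i j ≡ (if does (i Fin.≟ j) then R else 0ℚ)
  D′-regular i j = cong (λ r → if does (i Fin.≟ j) then r else 0ℚ) (Σ-A′-row i)

  module _ (x : Fin n → ℚ) where

    S P T : ℚ
    S = Σ n (λ i → x i * x i)
    P = quadForm (adjMatrix G) x
    T = Σ n (λ i → matVec (adjMatrix G) x i * matVec (adjMatrix G) x i)

    quadForm-degMatrix : quadForm (degMatrix G) x ≡ K * S
    quadForm-degMatrix = trans (quadForm-cong degMatrix-regular x) (quadForm-scalar K x)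

    quadForm-D′ : quadForm (D′ G) x ≡ R * S
    quadForm-D′ = trans (quadForm-cong D′-regular x) (quadForm-scalar R x)

    quadForm-A′ : quadForm (A′ G) x ≡ (ℤ.+ 1 / 12) * ((ℤ.+ 16 / 1 * P - T) + K * S)
    quadForm-A′ = begin
      quadForm (A′ G) x
        ≡⟨ quadForm-*ˡ (ℤ.+ 1 / 12) _ x ⟩
      (ℤ.+ 1 / 12) * quadForm (λ i j → (ℤ.+ 16 / 1 * adjMatrix G i j - matMul (adjMatrix G) (adjMatrix G) i j)
                                        + degMatrix G i j) x
        ≡⟨ cong ((ℤ.+ 1 / 12) *_) (trans (quadForm-+ _ (degMatrix G) x) (cong₂ _+_
             (trans (quadForm-- _ _ x) (cong₂ _-_
               (quadForm-*ˡ (ℤ.+ 16 / 1) (adjMatrix G) x)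
               (quadForm-matMul-sym (adjMatrix G) (adjMatrix-sym G) x)))
             quadForm-degMatrix)) ⟩
      (ℤ.+ 1 / 12) * ((ℤ.+ 16 / 1 * P - T) + K * S) ∎

    quadForm-laplacian-regular : quadForm (laplacian G) x ≡ K * S - P
    quadForm-laplacian-regular =
      trans (quadForm-- (degMatrix G) (adjMatrix G) x) (cong (_- P) quadForm-degMatrix)

    Σ-[Kx-Ax]² : Σ n (λ i → (K * x i - matVec (adjMatrix G) x i) * (K * x i - matVec (adjMatrix G) x i))
               ≡ (K * K) * S - (fromℕ 2 * K) * P + T
    Σ-[Kx-Ax]² = begin
      Σ n (λ i → (K * x i - y i) * (K * x i - y i))
        ≡⟨ Σ-cong n (λ i → solve 3 (λ k u v → (k :* u :- v) :* (k :* u :- v)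
                              := ((k :* k) :* (u :* u) :- (con (fromℕ 2) :* k) :* (u :* v)) :+ v :* v)
                              refl K (x i) (y i)) ⟩
      Σ n (λ i → ((K * K) * (x i * x i) - (fromℕ 2 * K) * (x i * y i)) + y i * y i)
        ≡⟨ Σ-distrib-+ n _ _ ⟩
      Σ n (λ i → (K * K) * (x i * x i) - (fromℕ 2 * K) * (x i * y i)) + T
        ≡⟨ cong (_+ T) (Σ-distrib-- n _ _) ⟩
      (Σ n (λ i → (K * K) * (x i * x i)) - Σ n (λ i → (fromℕ 2 * K) * (x i * y i))) + T
        ≡⟨ cong (_+ T) (cong₂ _-_ (*-distribˡ-Σ n (K * K) _) (*-distribˡ-Σ n (fromℕ 2 * K) _)) ⟨
      ((K * K) * S - (fromℕ 2 * K) * Σ n (λ i → x i * y i)) + T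
        ≡⟨ cong (λ p → ((K * K) * S - (fromℕ 2 * K) * p) + T) (quadForm-matVec (adjMatrix G) x) ⟨
      (K * K) * S - (fromℕ 2 * K) * P + T ∎
      where
      y : Fin n → ℚ
      y = matVec (adjMatrix G) x

    quadForm-twoLaplacian : quadForm (twoLaplacian G) x
      ≡ (ℤ.+ 1 / 12) * (Σ n (λ i → (K * x i - matVec (adjMatrix G) x i) * (K * x i - matVec (adjMatrix G) x i))
                        + fromℕ 2 * (fromℕ 8 - K) * quadForm (laplacian G) x)
    quadForm-twoLaplacian = begin
      quadForm (twoLaplacian G) x
        ≡⟨ quadForm-- (D′ G) (A′ G) x ⟩
      quadForm (D′ G) x - quadForm (A′ G) x
        ≡⟨ cong₂ _-_ quadForm-D′ quadForm-A′ ⟩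
      R * S - (ℤ.+ 1 / 12) * ((ℤ.+ 16 / 1 * P - T) + K * S)
        ≡⟨ solve 4 (λ k s p t →
             con (ℤ.+ 1 / 12) :* ((con (ℤ.+ 16 / 1) :* k :- k :* k) :+ k) :* s
               :- con (ℤ.+ 1 / 12) :* ((con (ℤ.+ 16 / 1) :* p :- t) :+ k :* s)
             := con (ℤ.+ 1 / 12) :* (((k :* k) :* s :- (con (fromℕ 2) :* k) :* p :+ t)
                                     :+ con (fromℕ 2) :* (con (fromℕ 8) :- k) :* (k :* s :- p)))
             refl K S P T ⟩
      (ℤ.+ 1 / 12) * (((K * K) * S - (fromℕ 2 * K) * P + T) + fromℕ 2 * (fromℕ 8 - K) * (K * S - P))
        ≡⟨ cong₂ (λ q l → (ℤ.+ 1 / 12) * (q + fromℕ 2 * (fromℕ 8 - K) * l))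
             Σ-[Kx-Ax]² quadForm-laplacian-regular ⟨
      (ℤ.+ 1 / 12) * (Σ n (λ i → (K * x i - matVec (adjMatrix G) x i) * (K * x i - matVec (adjMatrix G) x i))
                        + fromℕ 2 * (fromℕ 8 - K) * quadForm (laplacian G) x) ∎

corollary6p3 : ∀ (n k : ℕ) (G : SimpleGraph n) →
    IsRegular G k → k ≤ 8 → PosSemidef (twoLaplacian G)
corollary6p3 n k G regular k≤8 x =
  subst (0ℚ ≤ℚ_) (sym (quadForm-twoLaplacian x))
    (*-nonNeg (nonNegative⁻¹ (ℤ.+ 1 / 12))
      (+-mono-≤ (Σ-nonNeg n _ (λ i → square-nonNeg (K * x i - matVec (adjMatrix G) x i)))
                (*-nonNeg (*-nonNeg (fromℕ-nonNeg 2) (fromℕ-difference-nonNeg k≤8))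
                          (laplacian-posSemidef G x))))
  where open Regular G regular
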